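{- Let $\mathsf{P}$ be a finite graded poset of rank $r$, $\kappa>0$, $\pi\in\mathcal{F}^{\mathrm{B}}_\kappa(\mathsf{P})$, $0\le i\le r$ and $x\in\mathsf{P}$ of rank $i$. Then $(\mathrm{rvac}^{\mathrm{B}}_{\mathcal{F}}\pi)(x)=((\rho^{\mathrm{B}}_{\mathcal{F}})^{i+1}\pi)(x)$.
   Context: $\mathsf{P}$ is graded of rank $r$ (minimal elements rank $0$, maximal rank $r$, rank increases by $1$ along covers); $\mathsf{P}_i$ = rank-$i$ elements. $\widehat{\mathsf{P}}$ adds a minimum $\widehat0$ and maximum $\widehat1$; $\lessdot$ is covering in $\widehat{\mathsf{P}}$. $\mathcal{F}^{\mathrm{B}}_\kappa(\mathsf{P})=\{\pi\colon\widehat{\mathsf{P}}\to\mathbb{R}_{>0}:\pi(\widehat0)=1,\pi(\widehat1)=\kappa\}$. Toggle $t_p$ changes only the value at $p$, to $\dfrac{\sum_{y\lessdot p}\pi(y)}{\pi(p)\sum_{p\lessdot y}1/\pi(y)}$; $\mathbf{t}_i=\prod_{p\in\mathsf{P}_i}t_p$; products are compositions, rightmost first. $\rho^{\mathrm{B}}_{\mathcal{F}}=\mathbf{t}_0\mathbf{t}_1\cdots\mathbf{t}_r$ and $\mathrm{rvac}^{\mathrm{B}}_{\mathcal{F}}=(\mathbf{t}_r)(\mathbf{t}_{r-1}\mathbf{t}_r)\cdots(\mathbf{t}_1\cdots\mathbf{t}_r)(\mathbf{t}_0\mathbf{t}_1\cdots\mathbf{t}_r)$. -}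

module Defs where

open import Data.Nat using (ℕ; zero; suc; _∸_)
open import Data.Fin using (Fin)
open import Data.Fin.Properties using (all?; any?)
open import Data.List using (List; []; _∷_; foldr; map; filter; allFin; _++_)
open import Data.Product using (Σ; ∃; _×_; _,_)
open import Data.Sum using (_⊎_)
open import Data.Bool using (Bool; true; false; if_then_else_)
open import Relation.Nullary using (¬_; Dec; yes; no; _×-dec_; ¬?)
open import Relation.Nullary.Decidable using (⌊_⌋)
open import Relation.Binary.PropositionalEquality using (_≡_; _≢_)
open import Relation.Binary.Structures using (IsPartialOrder; IsStrictTotalOrder)
open import Relation.Binary.Definitions using (Decidable)
open import Algebra.Structures using (IsCommutativeRing)
open import Data.Fin.Properties using (_≟_)

-- The real numbers, axiomatised as a complete ordered field
-- (propositional equality; total inverse with 0⁻¹ unspecified).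

record RealField : Set₁ where
  infixl 6 _+_
  infixl 7 _*_
  infix 4 _<_ _≤_
  field
    ℝ   : Set
    _+_ _*_ : ℝ → ℝ → ℝ
    -_  : ℝ → ℝ
    0# 1# : ℝ
    _⁻¹ : ℝ → ℝ
    _<_ : ℝ → ℝ → Set
    isCommutativeRing : IsCommutativeRing _≡_ _+_ _*_ -_ 0# 1#
    *-inverse : ∀ x → x ≢ 0# → x * (x ⁻¹) ≡ 1#
    isStrictTotalOrder : IsStrictTotalOrder _≡_ _<_
    0<1   : 0# < 1#
    +-mono-< : ∀ {x y} z → x < y → x + z < y + z
    *-pos : ∀ {x y} → 0# < x → 0# < y → 0# < x * y
  _≤_ : ℝ → ℝ → Set
  x ≤ y = (x < y) ⊎ (x ≡ y)
  field
    sup : (S : ℝ → Set) → ∃ S → (∃ λ b → ∀ s → S s → s ≤ b) →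
          ∃ λ u → (∀ s → S s → s ≤ u) × (∀ b → (∀ s → S s → s ≤ b) → u ≤ b)

record FinPoset (n : ℕ) : Set₁ where
  field
    _≼_ : Fin n → Fin n → Set
    _≼?_ : Decidable _≼_
    isPartialOrder : IsPartialOrder _≡_ _≼_

  _≺_ : Fin n → Fin n → Set
  x ≺ y = (x ≼ y) × (x ≢ y)

  _≺?_ : Decidable _≺_
  x ≺? y = (x ≼? y) ×-dec ¬? (x ≟ y)

  _⋖_ : Fin n → Fin n → Set
  x ⋖ y = (x ≺ y) × (∀ z → ¬ ((x ≺ z) × (z ≺ y)))

  _⋖?_ : Decidable _⋖_
  x ⋖? y = (x ≺? y) ×-dec all? (λ z → ¬? ((x ≺? z) ×-dec (z ≺? y)))

  Minimal : Fin n → Set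
  Minimal x = ∀ y → ¬ (y ≺ x)

  minimal? : ∀ x → Dec (Minimal x)
  minimal? x = all? (λ y → ¬? (y ≺? x))

  Maximal : Fin n → Set
  Maximal x = ∀ y → ¬ (x ≺ y)

  maximal? : ∀ x → Dec (Maximal x)
  maximal? x = all? (λ y → ¬? (x ≺? y))

record IsGraded {n : ℕ} (P : FinPoset n) (r : ℕ) : Set where
  open FinPoset P
  field
    rk : Fin n → ℕ
    rk-min : ∀ x → Minimal x → rk x ≡ 0
    rk-max : ∀ x → Maximal x → rk x ≡ r
    rk-cov : ∀ x y → x ⋖ y → rk y ≡ suc (rk x)

-- The bounded poset P̂ = P ⊔ {0̂, 1̂}

data Hat (n : ℕ) : Set where
  bot : Hat n
  top : Hat n
  el  : Fin n → Hat n

module Birational (R : RealField) {n : ℕ} (P : FinPoset n) (r : ℕ)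
                  (G : IsGraded P r) where
  open RealField R
  open FinPoset P
  open IsGraded G

  Labelling : Set
  Labelling = Hat n → ℝ

  lowerCovers : Fin n → List (Hat n)
  lowerCovers p =
    (if ⌊ minimal? p ⌋ then bot ∷ [] else []) ++
    map el (filter (λ y → y ⋖? p) (allFin n))

  upperCovers : Fin n → List (Hat n)
  upperCovers p =
    (if ⌊ maximal? p ⌋ then top ∷ [] else []) ++
    map el (filter (λ y → p ⋖? y) (allFin n))

  sumℝ : List ℝ → ℝ
  sumℝ = foldr _+_ 0#

  toggle : Fin n → Labelling → Labelling
  toggle p π bot = π bot
  toggle p π top = π top
  toggle p π (el q) with p ≟ q
  ... | yes _ = sumℝ (map π (lowerCovers p)) *
                 ((π (el p) * sumℝ (map (λ y → π y ⁻¹) (upperCovers p))) ⁻¹)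
  ... | no _  = π (el q)

  toggleRank : ℕ → Labelling → Labelling
  toggleRank i π = foldr toggle π (filter (λ p → rk p Data.Nat.≟ i) (allFin n))

  -- segment k m : 𝐭_k 𝐭_{k+1} ⋯ 𝐭_{k+m-1}  (rightmost applied first)
  segment : ℕ → ℕ → Labelling → Labelling
  segment k zero    π = π
  segment k (suc m) π = toggleRank k (segment (suc k) m π)

  tailToggles : ℕ → Labelling → Labelling
  tailToggles k = segment k (suc r ∸ k)

  rowmotion : Labelling → Labelling
  rowmotion = tailToggles 0

  iterate : ℕ → (Labelling → Labelling) → Labelling → Labelling
  iterate zero    f π = π
  iterate (suc m) f π = f (iterate m f π)

  rvacUpTo : ℕ → Labelling → Labelling
  rvacUpTo zero    π = π
  rvacUpTo (suc m) π = tailToggles m (rvacUpTo m π)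

  rvac : Labelling → Labelling
  rvac = rvacUpTo (suc r)

  InF : ℝ → Labelling → Set
  InF κ π = (∀ q → 0# < π q) × (π bot ≡ 1#) × (π top ≡ κ)

{-# OPTIONS --safe #-}

-- A toggle t_p reads labels only at p and at the elements covering or covered by p,
-- so 𝐭_k leaves every rank other than k fixed, and 𝐭_a, 𝐭_k commute when |a − k| ≥ 2.
-- By induction on j, ρ^{j+1} π arises from (𝐭_j⋯𝐭_r)⋯(𝐭_0⋯𝐭_r) π by toggles of rank < j:
-- writing ρ = (𝐭_0⋯𝐭_j)(𝐭_{j+1}⋯𝐭_r), the factor 𝐭_{j+1}⋯𝐭_r commutes past those
-- toggles and 𝐭_0⋯𝐭_j only adds toggles of rank ≤ j. So both agree at rank j, and the
-- remaining factors of rvac only toggle higher ranks.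
module Submission where

open import Defs
open import Data.Nat using (ℕ; zero; suc; _+_; _∸_; _≤_; _<_; _≤′_; ≤′-refl; ≤′-step; s≤s)
open import Data.Nat.Properties
  using (≤-refl; ≤-trans; n≤1+n; m≤n⇒m≤1+n; m≤m+n; <⇒≢; >⇒≢; <⇒≱; <-≤-trans;
         +-suc; +-identityʳ; m+[n∸m]≡n; ≤⇒≤′; ≤′⇒≤)
import Data.Nat as ℕ
open import Data.Fin using (Fin)
open import Data.Fin.Properties using (_≟_)
open import Data.List using (List; []; _∷_; foldr; filter; allFin)
open import Data.List.Properties using (map-cong-local)
open import Data.List.Relation.Unary.All as All using (All; []; _∷_)
open import Data.List.Relation.Unary.All.Properties using (++⁺; map⁺; all-filter)
open import Data.Product using (_×_; _,_)
open import Data.Unit using (⊤; tt)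
open import Data.Empty using (⊥-elim)
open import Data.Bool using (true; false; if_then_else_)
open import Relation.Nullary using (yes; no)
open import Relation.Nullary.Decidable using (⌊_⌋)
open import Relation.Binary.PropositionalEquality
  using (_≡_; _≢_; _≗_; refl; sym; trans; cong; cong₂; subst; module ≡-Reasoning)

module RowmotionReversal (R : RealField) {n : ℕ} (P : FinPoset n) (r : ℕ) (G : IsGraded P r) where
  open RealField R using (_*_; _⁻¹)
  open FinPoset P
  open IsGraded G
  open Birational R P r G
  open ≡-Reasoning

  OnRanks : (ℕ → Set) → Hat n → Set
  OnRanks A bot    = ⊤
  OnRanks A top    = ⊤
  OnRanks A (el q) = A (rk q)

  OnRanks-map : ∀ {A B : ℕ → Set} → (∀ {m} → A m → B m) → ∀ q → OnRanks A q → OnRanks B q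
  OnRanks-map f bot    _ = tt
  OnRanks-map f top    _ = tt
  OnRanks-map f (el q) a = f a

  OnRanks-universal : ∀ q → OnRanks (λ _ → ⊤) q
  OnRanks-universal bot    = tt
  OnRanks-universal top    = tt
  OnRanks-universal (el q) = tt

  EqualOn : (Hat n → Set) → Labelling → Labelling → Set
  EqualOn S σ τ = ∀ q → S q → σ q ≡ τ q

  rankElements : ℕ → List (Fin n)
  rankElements a = filter (λ p → rk p ℕ.≟ a) (allFin n)

  rankElements-rank : ∀ a → All (λ p → rk p ≡ a) (rankElements a)
  rankElements-rank a = all-filter (λ p → rk p ℕ.≟ a) (allFin n)

  toggles-fix : ∀ a (ps : List (Fin n)) → All (λ p → rk p ≡ a) ps →
                ∀ σ → EqualOn (OnRanks (_≢ a)) (foldr toggle σ ps) σ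
  toggles-fix a []       _          σ q      _  = refl
  toggles-fix a (p ∷ ps) (_ ∷ rks)  σ bot    _  = toggles-fix a ps rks σ bot tt
  toggles-fix a (p ∷ ps) (_ ∷ rks)  σ top    _  = toggles-fix a ps rks σ top tt
  toggles-fix a (p ∷ ps) (rp ∷ rks) σ (el q) q≢a with p ≟ q
  ... | yes refl = ⊥-elim (q≢a rp)
  ... | no _     = toggles-fix a ps rks σ (el q) q≢a

  toggleRank-fix : ∀ a σ → EqualOn (OnRanks (_≢ a)) (toggleRank a σ) σ
  toggleRank-fix a = toggles-fix a (rankElements a) (rankElements-rank a)

  ContainsNeighbours : ℕ → (ℕ → Set) → Set
  ContainsNeighbours a A = (∀ {m} → suc m ≡ a → A m) × A (suc a)

  lowerCovers-onRanks : ∀ {A} p → (∀ {m} → suc m ≡ rk p → A m) → All (OnRanks A) (lowerCovers p)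
  lowerCovers-onRanks {A} p below =
    ++⁺ minimalPart (map⁺ (All.map (λ y⋖p → below (sym (rk-cov _ p y⋖p))) (all-filter (λ y → y ⋖? p) (allFin n))))
    where
    minimalPart : All (OnRanks A) (if ⌊ minimal? p ⌋ then bot ∷ [] else [])
    minimalPart with ⌊ minimal? p ⌋
    ... | true  = tt ∷ []
    ... | false = []

  upperCovers-onRanks : ∀ {A} p → A (suc (rk p)) → All (OnRanks A) (upperCovers p)
  upperCovers-onRanks {A} p above =
    ++⁺ maximalPart (map⁺ (All.map (λ p⋖y → subst A (sym (rk-cov p _ p⋖y)) above) (all-filter (λ y → p ⋖? y) (allFin n))))
    where
    maximalPart : All (OnRanks A) (if ⌊ maximal? p ⌋ then top ∷ [] else [])
    maximalPart with ⌊ maximal? p ⌋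
    ... | true  = tt ∷ []
    ... | false = []

  toggle-local : ∀ {A} p → ContainsNeighbours (rk p) A → ∀ {σ τ} →
                 EqualOn (OnRanks A) σ τ → EqualOn (OnRanks A) (toggle p σ) (toggle p τ)
  toggle-local p nbrs σ≡τ bot    s = σ≡τ bot s
  toggle-local p nbrs σ≡τ top    s = σ≡τ top s
  toggle-local p (below , above) σ≡τ (el q) s with p ≟ q
  ... | yes refl =
    cong₂ _*_ (cong sumℝ (map-cong-local (All.map (λ {y} → σ≡τ y) (lowerCovers-onRanks p below))))
              (cong _⁻¹ (cong₂ _*_ (σ≡τ (el p) s) (cong sumℝ (map-cong-local
                (All.map (λ {y} t → cong _⁻¹ (σ≡τ y t)) (upperCovers-onRanks p above))))))
  ... | no _ = σ≡τ (el q) s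

  toggles-local : ∀ {A} a → ContainsNeighbours a A → ∀ ps → All (λ p → rk p ≡ a) ps → ∀ {σ τ} →
                  EqualOn (OnRanks A) σ τ → EqualOn (OnRanks A) (foldr toggle σ ps) (foldr toggle τ ps)
  toggles-local a nbrs []       _            σ≡τ = σ≡τ
  toggles-local a nbrs (p ∷ ps) (refl ∷ rks) σ≡τ = toggle-local p nbrs (toggles-local a nbrs ps rks σ≡τ)

  toggleRank-local : ∀ {A} a → ContainsNeighbours a A → ∀ {σ τ} →
                     EqualOn (OnRanks A) σ τ → EqualOn (OnRanks A) (toggleRank a σ) (toggleRank a τ)
  toggleRank-local a nbrs = toggles-local a nbrs (rankElements a) (rankElements-rank a)

  toggleRank-cong : ∀ a {σ τ} → σ ≗ τ → toggleRank a σ ≗ toggleRank a τ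
  toggleRank-cong a σ≗τ q =
    toggleRank-local a ((λ _ → tt) , tt) (λ q _ → σ≗τ q) q (OnRanks-universal q)

  Adjacent : ℕ → ℕ → Set
  Adjacent a m = a ≤ suc m × m ≤ suc a

  adjacent-reflexive : ∀ {a m} → m ≡ a → Adjacent a m
  adjacent-reflexive refl = n≤1+n _ , n≤1+n _

  adjacent-neighbours : ∀ a → ContainsNeighbours a (Adjacent a)
  adjacent-neighbours a = (λ { refl → ≤-refl , m≤n⇒m≤1+n (n≤1+n _) }) , (m≤n⇒m≤1+n (n≤1+n a) , ≤-refl)

  toggleRank-comm-at : ∀ a k σ → (∀ {m} → Adjacent a m → m ≢ k) → ∀ q → rk q ≡ a →
                       toggleRank a (toggleRank k σ) (el q) ≡ toggleRank k (toggleRank a σ) (el q)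
  toggleRank-comm-at a k σ apart q q∈a = begin
    toggleRank a (toggleRank k σ) (el q) ≡⟨ toggleRank-local a (adjacent-neighbours a) unchanged (el q) q∼a ⟩
    toggleRank a σ (el q)                ≡⟨ toggleRank-fix k (toggleRank a σ) (el q) (apart q∼a) ⟨
    toggleRank k (toggleRank a σ) (el q) ∎
    where
    q∼a = adjacent-reflexive q∈a
    unchanged : EqualOn (OnRanks (Adjacent a)) (toggleRank k σ) σ
    unchanged q′ q′∼a = toggleRank-fix k σ q′ (OnRanks-map apart q′ q′∼a)

  toggleRank-comm-off : ∀ a k σ q → OnRanks (_≢ a) q → OnRanks (_≢ k) q →
                        toggleRank a (toggleRank k σ) q ≡ toggleRank k (toggleRank a σ) q
  toggleRank-comm-off a k σ q q∉a q∉k = begin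
    toggleRank a (toggleRank k σ) q ≡⟨ toggleRank-fix a (toggleRank k σ) q q∉a ⟩
    toggleRank k σ q                ≡⟨ toggleRank-fix k σ q q∉k ⟩
    σ q                             ≡⟨ toggleRank-fix a σ q q∉a ⟨
    toggleRank a σ q                ≡⟨ toggleRank-fix k (toggleRank a σ) q q∉k ⟨
    toggleRank k (toggleRank a σ) q ∎

  adjacent-apart-below : ∀ {a k m} → suc k < a → Adjacent a m → m ≢ k
  adjacent-apart-below k+1<a (a≤1+m , _) refl = <⇒≱ k+1<a a≤1+m

  adjacent-apart-above : ∀ {a k m} → suc k < a → Adjacent k m → m ≢ a
  adjacent-apart-above k+1<a (_ , m≤1+k) refl = <⇒≱ k+1<a m≤1+k

  toggleRank-comm : ∀ a k → suc k < a → ∀ σ → toggleRank a (toggleRank k σ) ≗ toggleRank k (toggleRank a σ)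
  toggleRank-comm a k k+1<a σ bot = toggleRank-comm-off a k σ bot tt tt
  toggleRank-comm a k k+1<a σ top = toggleRank-comm-off a k σ top tt tt
  toggleRank-comm a k k+1<a σ (el q) with rk q ℕ.≟ a | rk q ℕ.≟ k
  ... | yes q∈a | _       = toggleRank-comm-at a k σ (adjacent-apart-below k+1<a) q q∈a
  ... | no _    | yes q∈k = sym (toggleRank-comm-at k a σ (adjacent-apart-above k+1<a) q q∈k)
  ... | no q∉a  | no q∉k  = toggleRank-comm-off a k σ (el q) q∉a q∉k

  segment-fix-below : ∀ s m σ → EqualOn (OnRanks (_< s)) (segment s m σ) σ
  segment-fix-below s zero    σ q q<s = refl
  segment-fix-below s (suc m) σ q q<s =
    trans (toggleRank-fix s (segment (suc s) m σ) q (OnRanks-map <⇒≢ q q<s))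
          (segment-fix-below (suc s) m σ q (OnRanks-map m≤n⇒m≤1+n q q<s))

  segment-cong : ∀ s m {σ τ} → σ ≗ τ → segment s m σ ≗ segment s m τ
  segment-cong s zero    σ≗τ = σ≗τ
  segment-cong s (suc m) σ≗τ = toggleRank-cong s (segment-cong (suc s) m σ≗τ)

  segment-comm : ∀ s m k → suc k < s → ∀ σ → segment s m (toggleRank k σ) ≗ toggleRank k (segment s m σ)
  segment-comm s zero    k k+1<s σ q = refl
  segment-comm s (suc m) k k+1<s σ q =
    trans (toggleRank-cong s (segment-comm (suc s) m k (m≤n⇒m≤1+n k+1<s) σ) q)
          (toggleRank-comm s k k+1<s (segment (suc s) m σ) q)

  segment-+ : ∀ k m l σ → segment k (m + l) σ ≡ segment k m (segment (k + m) l σ)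
  segment-+ k zero    l σ rewrite +-identityʳ k = refl
  segment-+ k (suc m) l σ rewrite +-suc k m     = cong (toggleRank k) (segment-+ (suc k) m l σ)

  -- Closed under _≗_ because toggles commute only pointwise (there is no funext).
  data ToggledBelow (j : ℕ) (π : Labelling) : Labelling → Set where
    start : ToggledBelow j π π
    step  : ∀ {σ} k → k < j → ToggledBelow j π σ → ToggledBelow j π (toggleRank k σ)
    resp  : ∀ {σ τ} → σ ≗ τ → ToggledBelow j π σ → ToggledBelow j π τ

  toggledBelow-agree : ∀ {j π σ} → ToggledBelow j π σ → EqualOn (OnRanks (j ≤_)) π σ
  toggledBelow-agree start          q j≤q = refl
  toggledBelow-agree (step k k<j t) q j≤q =
    trans (toggledBelow-agree t q j≤q)
          (sym (toggleRank-fix k _ q (OnRanks-map (λ j≤m → >⇒≢ (<-≤-trans k<j j≤m)) q j≤q)))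
  toggledBelow-agree (resp σ≗τ t)   q j≤q = trans (toggledBelow-agree t q j≤q) (σ≗τ q)

  toggledBelow-mono : ∀ {j j′ π σ} → j ≤ j′ → ToggledBelow j π σ → ToggledBelow j′ π σ
  toggledBelow-mono j≤j′ start          = start
  toggledBelow-mono j≤j′ (step k k<j t) = step k (≤-trans k<j j≤j′) (toggledBelow-mono j≤j′ t)
  toggledBelow-mono j≤j′ (resp σ≗τ t)   = resp σ≗τ (toggledBelow-mono j≤j′ t)

  toggledBelow-segment : ∀ {j π σ} k m → k + m ≤ j → ToggledBelow j π σ → ToggledBelow j π (segment k m σ)
  toggledBelow-segment k zero    _   t = t
  toggledBelow-segment {j} k (suc m) k+m+1≤j t =
    step k (≤-trans (s≤s (m≤m+n k m)) k+m<j) (toggledBelow-segment (suc k) m k+m<j t)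
    where
    k+m<j : suc (k + m) ≤ j
    k+m<j = subst (_≤ j) (+-suc k m) k+m+1≤j

  toggledBelow-segment-above : ∀ {j π σ} m → ToggledBelow j π σ →
                               ToggledBelow j (segment (suc j) m π) (segment (suc j) m σ)
  toggledBelow-segment-above m start = start
  toggledBelow-segment-above {j} m (step {σ} k k<j t) =
    resp (λ q → sym (segment-comm (suc j) m k (s≤s k<j) σ q)) (step k k<j (toggledBelow-segment-above m t))
  toggledBelow-segment-above {j} m (resp σ≗τ t) =
    resp (segment-cong (suc j) m σ≗τ) (toggledBelow-segment-above m t)

  rowmotion-split : ∀ j → j ≤ r → ∀ σ → segment 0 (suc j) (tailToggles (suc j) σ) ≡ rowmotion σ
  rowmotion-split j j≤r σ = begin
    segment 0 (suc j) (segment (suc j) (r ∸ j) σ) ≡⟨ segment-+ 0 (suc j) (r ∸ j) σ ⟨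
    segment 0 (suc j + (r ∸ j)) σ                 ≡⟨ cong (λ l → segment 0 (suc l) σ) (m+[n∸m]≡n j≤r) ⟩
    segment 0 (suc r) σ                           ∎

  rvacUpTo-toggledBelow-rowmotion : ∀ π j → j ≤ r →
                                    ToggledBelow j (rvacUpTo (suc j) π) (iterate (suc j) rowmotion π)
  rvacUpTo-toggledBelow-rowmotion π zero    _     = start
  rvacUpTo-toggledBelow-rowmotion π (suc j) j+1≤r =
    subst (ToggledBelow (suc j) (rvacUpTo (suc (suc j)) π)) (rowmotion-split j j≤r σ)
      (toggledBelow-segment 0 (suc j) ≤-refl
        (toggledBelow-mono (n≤1+n j)
          (toggledBelow-segment-above (r ∸ j) (rvacUpTo-toggledBelow-rowmotion π j j≤r))))
    where
    j≤r = ≤-trans (n≤1+n j) j+1≤r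
    σ = iterate (suc j) rowmotion π

  rvacUpTo-stable : ∀ π {m m′} → m ≤′ m′ → EqualOn (OnRanks (_< m)) (rvacUpTo m′ π) (rvacUpTo m π)
  rvacUpTo-stable π ≤′-refl q q<m = refl
  rvacUpTo-stable π (≤′-step {m′} m≤m′) q q<m =
    trans (segment-fix-below m′ (suc r ∸ m′) (rvacUpTo m′ π) q
            (OnRanks-map (λ k<m → <-≤-trans k<m (≤′⇒≤ m≤m′)) q q<m))
          (rvacUpTo-stable π m≤m′ q q<m)

proposition2p37 : (R : RealField) {n : ℕ} (P : FinPoset n) (r : ℕ) (G : IsGraded P r) → (κ : RealField.ℝ R) → RealField._<_ R (RealField.0# R) κ → (π : Hat n → RealField.ℝ R) → Birational.InF R P r G κ π → (i : ℕ) → i ≤ r → (x : Fin n) → IsGraded.rk G x ≡ i → Birational.rvac R P r G π (el x) ≡ Birational.iterate R P r G (suc i) (Birational.rowmotion R P r G) π (el x)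
proposition2p37 R P r G κ _ π _ i i≤r x refl =
  trans (rvacUpTo-stable π (≤⇒≤′ (s≤s i≤r)) (el x) ≤-refl)
        (toggledBelow-agree (rvacUpTo-toggledBelow-rowmotion π i i≤r) (el x) ≤-refl)
  where open RowmotionReversal R P r G
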